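{- Let $G$ be a graph, let $P$ be a path of maximum length in $G$ starting at some vertex $p_0$, let $S$ be the set of all ending vertices for $P$, and let $X$ be a connected set of ending vertices for $P$. Then (i) $|N(X)|\leq 2|S|$; and (ii) there is a cycle in $G$ containing $N(X)\cup X$.
   Context: If $P=p_1p_2\dots p_t$ is a path in $G$ and $p_tp_i$ is an edge of $G$, the path $p_1p_2\dots p_i p_t p_{t-1}\dots p_{i+1}$ is called a rotation of $P$. A path $Q$ is derived from $P$ if there is a sequence of paths $P_0=P,P_1,\dots,P_s=Q$ with each $P_j$ a rotation of $P_{j-1}$. A vertex $x$ is an ending vertex for $P$ if it is the final vertex of some path derived from $P$. A set $X$ of ending vertices for $P$ is connected if for every $x\in X$ there is a sequence of paths $P=P_0,P_1,\dots,P_s$ with $P_s$ ending at $x$, each $P_j$ a rotation of $P_{j-1}$, and each $P_j$ ending at some vertex of $X$. For a vertex set $S$, $N(S)=N_G(S)$ is the set of vertices $v\in V(G)\setminus S$ adjacent to some vertex of $S$. -}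

module Defs where

open import Level using (0ℓ)
open import Data.Nat using (ℕ; _≤_; _≥_)
open import Data.Fin using (Fin)
open import Data.Fin.Subset using (Subset; _∈_; _∉_)
open import Data.List using (List; []; _∷_; _++_; _∷ʳ_; reverse; length)
open import Data.List.Relation.Unary.Linked using (Linked)
open import Data.List.Relation.Unary.Unique.Propositional using (Unique)
open import Data.Product using (Σ; ∃; _×_)
open import Relation.Nullary using (¬_)
open import Relation.Binary.PropositionalEquality using (_≡_; _≢_)
open import Relation.Binary.Construct.Closure.ReflexiveTransitive using (Star)

record Graph (n : ℕ) : Set₁ where
  field
    Adj     : Fin n → Fin n → Set
    sym     : ∀ {u v} → Adj u v → Adj v u
    irrefl  : ∀ {u} → ¬ Adj u u

open Graph public

module _ {n : ℕ} (G : Graph n) where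

  -- A path: a nonempty list of distinct vertices, consecutive ones adjacent.
  -- Its length is measured by the number of vertices (equivalent for comparisons).
  IsPath : List (Fin n) → Set
  IsPath ps = (ps ≢ []) × Unique ps × Linked (Adj G) ps

  StartsAt : List (Fin n) → Fin n → Set
  StartsAt ps v = Σ (List (Fin n)) λ ys → ps ≡ v ∷ ys

  EndsAt : List (Fin n) → Fin n → Set
  EndsAt ps v = Σ (List (Fin n)) λ ys → ps ≡ ys ∷ʳ v

  IsLongestPath : List (Fin n) → Set
  IsLongestPath P = IsPath P × (∀ Q → IsPath Q → length Q ≤ length P)

  Rotation : List (Fin n) → List (Fin n) → Set
  Rotation P Q =
    Σ (List (Fin n)) λ xs → Σ (Fin n) λ pᵢ → Σ (List (Fin n)) λ ys → Σ (Fin n) λ pₜ →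
      (P ≡ (xs ∷ʳ pᵢ) ++ (ys ∷ʳ pₜ)) ×
      Adj G pₜ pᵢ ×
      (Q ≡ (xs ∷ʳ pᵢ) ++ reverse (ys ∷ʳ pₜ))

  Derived : List (Fin n) → List (Fin n) → Set
  Derived = Star Rotation

  IsEndingVertex : List (Fin n) → Fin n → Set
  IsEndingVertex P x = Σ (List (Fin n)) λ Q → Derived P Q × EndsAt Q x

  EndsIn : Subset n → List (Fin n) → Set
  EndsIn X Q = Σ (Fin n) λ x → EndsAt Q x × x ∈ X

  RotationWithin : Subset n → List (Fin n) → List (Fin n) → Set
  RotationWithin X Q R = Rotation Q R × EndsIn X R

  IsConnectedEndingSet : List (Fin n) → Subset n → Set
  IsConnectedEndingSet P X =
    (∀ x → x ∈ X → IsEndingVertex P x) ×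
    (∀ x → x ∈ X →
       Σ (List (Fin n)) λ Q → EndsIn X P × Star (RotationWithin X) P Q × EndsAt Q x)

  IsNeighbourhood : Subset n → Subset n → Set
  IsNeighbourhood X N =
    ∀ v → (v ∈ N → (v ∉ X × Σ (Fin n) λ u → u ∈ X × Adj G u v)) ×
          ((v ∉ X × Σ (Fin n) λ u → u ∈ X × Adj G u v) → v ∈ N)

  -- Cycle, with the degenerate convention:
  -- a nonempty list c₁…cₖ of distinct vertices with consecutive ones adjacent
  -- and, when k ≥ 3, cₖ adjacent to c₁.  (k = 2 is a single edge, k = 1 a vertex.)
  IsCycle : List (Fin n) → Set
  IsCycle C = IsPath C ×
    (length C ≥ 3 → Σ (Fin n) λ c₁ → Σ (Fin n) λ cₖ → StartsAt C c₁ × EndsAt C cₖ × Adj G cₖ c₁)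

module Submission where

-- Pósa rotations along a longest path P.  A rotation (xs ∷ʳ p) ++ (ys ∷ʳ e) ↦
-- (xs ∷ʳ p) ++ reverse (ys ∷ʳ e) permutes the vertices, replaces the pair (p, y) by
-- (p, e) and makes y, the vertex following the pivot p, the new final vertex.  So
-- derived paths are longest paths, and all neighbours of their final vertex lie on them.
--
-- (i)  For v ∈ N(X) adjacent to u ∈ X, follow rotations inside X from P to a path
--      ending at u.  Until v is a pivot its neighbours along the path stay its
--      neighbours along P (v ∉ X is never an end); once v is a pivot -- at the latest
--      when rotating at v towards u -- its successor becomes an ending vertex.  So v is
--      the predecessor or successor on P of some s ∈ S, whence |N(X)| ≤ 2|S|.
-- (ii) Pivots of rotations inside X lie in N(X) ∪ X, so if b is the first vertex of
--      P = A ++ b ∷ R in N(X) ∪ X, rotations inside X keep A ++ [b].  Rotating to a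
--      path A ++ b ∷ R' ending at b or at a neighbour of b in X, the segment b ∷ R'
--      closes up to a cycle through N(X) ∪ X.

open import Defs hiding (sym)
open import Data.Nat using (ℕ; _≤_; _<_; _*_; _+_; z≤n; s≤s)
open import Data.Nat.Properties
  using (≤-trans; ≤-reflexive; +-mono-≤; +-suc; n≤1+n; <-irrefl; <-≤-trans; m<m+n; +-identityʳ; module ≤-Reasoning)
open import Data.Fin using (Fin; _≟_)
open import Data.Fin.Subset using (Subset; _∈_; _∉_; _∪_; ∣_∣; ⁅_⁆; ⊥; _-_; inside; outside)
open import Data.Fin.Subset.Properties
  using (x∈p∪q⁺; x∈p∪q⁻; x∈⁅x⁆; ∣⁅x⁆∣≡1; ∣⊥∣≡0; x∈p∧x≢y⇒x∈p-y; x∈p⇒∣p-x∣<∣p∣; p⊆q⇒∣p∣≤∣q∣)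
  renaming (_∈?_ to _∈ₛ?_)
open import Data.Vec using ([]; _∷_)
open import Data.Bool using (if_then_else_)
open import Data.List using (List; []; _∷_; _++_; _∷ʳ_; reverse; length; [_]; map; filter; allFin)
open import Data.List.Properties
  using (∷-injectiveˡ; ∷-injectiveʳ; ∷ʳ-injectiveʳ; unfold-reverse; reverse-++; reverse-involutive;
         ++-assoc; length-++; length-map)
open import Data.List.Membership.Propositional using () renaming (_∈_ to _∈ₗ_; _∉_ to _∉ₗ_)
open import Data.List.Membership.Propositional.Properties
  using (∈-++⁻; ∈-++⁺ˡ; ∈-++⁺ʳ; ∈-∃++; ∈-map⁺; ∈-filter⁺; ∈-filter⁻; ∈-allFin)
open import Data.List.Relation.Unary.Any using (here; there; any?)
open import Data.List.Relation.Unary.All using (All; []; _∷_) renaming (lookup to all-lookup)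
open import Data.List.Relation.Unary.AllPairs using ([]; _∷_)
open import Data.List.Relation.Unary.Linked using (Linked; []; [-]; _∷_) renaming (tail to linked-tail)
open import Data.List.Relation.Unary.Unique.Propositional using (Unique)
import Data.List.Relation.Unary.Unique.Propositional.Properties as Unique
import Data.List.Relation.Unary.First as First
open First using (FirstView; first)
open import Data.List.Relation.Unary.First.Properties using (toView)
open import Data.List.Relation.Binary.Permutation.Propositional using (_↭_; ↭-refl; ↭-sym; ↭-trans; ↭⇒↭ₛ)
open import Data.List.Relation.Binary.Permutation.Propositional.Properties
  using (↭-reverse; ++⁺ˡ; ↭-length; ↭-empty-inv; ∈-resp-↭)
import Data.List.Relation.Binary.Permutation.Setoid.Properties as SetoidPermutation
open import Data.Product using (Σ; _×_; _,_; proj₁; proj₂)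
open import Data.Sum using (_⊎_; inj₁; inj₂; swap)
open import Data.Empty using (⊥-elim)
open import Relation.Nullary using (¬_; yes; no; does)
open import Relation.Nullary.Decidable using (toSum)
open import Relation.Binary.PropositionalEquality
  using (_≡_; _≢_; refl; sym; trans; cong; cong₂; subst; setoid; module ≡-Reasoning)
open import Relation.Binary.Construct.Closure.ReflexiveTransitive using (Star; ε; _◅_; _◅◅_)
import Relation.Binary.Construct.Closure.ReflexiveTransitive as Star

data Consec {A : Set} : List A → A → A → Set where
  here  : ∀ {a b l} → Consec (a ∷ b ∷ l) a b
  there : ∀ {c a b l} → Consec l a b → Consec (c ∷ l) a b

Beside : {A : Set} → List A → A → A → Set
Beside L a b = Consec L a b ⊎ Consec L b a

unique-resp-↭ : {A : Set} {xs ys : List A} → xs ↭ ys → Unique xs → Unique ys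
unique-resp-↭ {A} p = SetoidPermutation.Unique-resp-↭ (setoid A) (↭⇒↭ₛ p)

↭-nonempty : {A : Set} {xs ys : List A} → xs ↭ ys → ys ≢ [] → xs ≢ []
↭-nonempty xs↭ys ys≢[] refl = ys≢[] (↭-empty-inv (↭-sym xs↭ys))

module _ {A : Set} where

  consec-++ˡ : ∀ {L M : List A} {a b} → Consec L a b → Consec (L ++ M) a b
  consec-++ˡ here      = here
  consec-++ˡ (there c) = there (consec-++ˡ c)

  consec-++ʳ : ∀ (L : List A) {M a b} → Consec M a b → Consec (L ++ M) a b
  consec-++ʳ []      c = c
  consec-++ʳ (x ∷ L) c = there (consec-++ʳ L c)

  consec-joint : ∀ (L : List A) {a b M} → Consec ((L ∷ʳ a) ++ b ∷ M) a b
  consec-joint []      = here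
  consec-joint (x ∷ L) = there (consec-joint L)

  consec-head-∈ : ∀ {L : List A} {a b} → Consec L a b → a ∈ₗ L
  consec-head-∈ here      = here refl
  consec-head-∈ (there c) = there (consec-head-∈ c)

  consec-split : ∀ (L : List A) {M a b} → Consec (L ++ M) a b →
    Consec L a b ⊎ Consec M a b ⊎
    ((Σ (List A) λ L' → L ≡ L' ∷ʳ a) × (Σ (List A) λ M' → M ≡ b ∷ M'))
  consec-split []            c         = inj₂ (inj₁ c)
  consec-split (x ∷ [])      here      = inj₂ (inj₂ (([] , refl) , (_ , refl)))
  consec-split (x ∷ [])      (there c) = inj₂ (inj₁ c)
  consec-split (x ∷ y ∷ L)   here      = inj₁ here
  consec-split (x ∷ y ∷ L)   (there c) with consec-split (y ∷ L) c
  ... | inj₁ c'                       = inj₁ (there c')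
  ... | inj₂ (inj₁ c')                = inj₂ (inj₁ c')
  ... | inj₂ (inj₂ ((L' , eq) , tl))  = inj₂ (inj₂ ((x ∷ L' , cong (x ∷_) eq) , tl))

  consec-reverse : ∀ {L : List A} {a b} → Consec L a b → Consec (reverse L) b a
  consec-reverse {a ∷ b ∷ l} here =
    subst (λ z → Consec z b a) (sym reverse-ab) (consec-joint (reverse l))
    where
    reverse-ab : reverse (a ∷ b ∷ l) ≡ (reverse l ∷ʳ b) ++ a ∷ []
    reverse-ab = trans (unfold-reverse a (b ∷ l)) (cong (_∷ʳ a) (unfold-reverse b l))
  consec-reverse {c ∷ l} (there p) =
    subst (λ z → Consec z _ _) (sym (unfold-reverse c l)) (consec-++ˡ (consec-reverse p))

  linked⇒consec : ∀ {R : A → A → Set} {L a b} → Linked R L → Consec L a b → R a b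
  linked⇒consec (r ∷ _)  here      = r
  linked⇒consec (_ ∷ rs) (there c) = linked⇒consec rs c
  linked⇒consec [-]      (there ())

  consec⇒linked : ∀ {R : A → A → Set} (L : List A) → (∀ {a b} → Consec L a b → R a b) → Linked R L
  consec⇒linked []          f = []
  consec⇒linked (x ∷ [])    f = [-]
  consec⇒linked (x ∷ y ∷ L) f = f here ∷ consec⇒linked (y ∷ L) (λ c → f (there c))

  reverse-tail-consec : ∀ (L : List A) p M e {a b} → Consec ((L ∷ʳ p) ++ reverse (M ∷ʳ e)) a b →
    Beside ((L ∷ʳ p) ++ (M ∷ʳ e)) a b ⊎ (a ≡ p × b ≡ e)
  reverse-tail-consec L p M e c with consec-split (L ∷ʳ p) c
  ... | inj₁ c' = inj₁ (inj₁ (consec-++ˡ c'))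
  ... | inj₂ (inj₁ c') =
    inj₁ (inj₂ (consec-++ʳ (L ∷ʳ p)
      (subst (λ z → Consec z _ _) (reverse-involutive (M ∷ʳ e)) (consec-reverse c'))))
  ... | inj₂ (inj₂ ((L' , eqL) , (M' , eqM))) =
    inj₂ (sym (∷ʳ-injectiveʳ L L' eqL) , sym (∷-injectiveˡ (trans (sym (reverse-++ M [ e ])) eqM)))

  nonempty-++ : ∀ (L : List A) {b M} → L ++ b ∷ M ≢ []
  nonempty-++ []      ()
  nonempty-++ (_ ∷ _) ()

  unique-suffix : ∀ (L : List A) {M} → Unique (L ++ M) → Unique M
  unique-suffix []      u       = u
  unique-suffix (_ ∷ L) (_ ∷ u) = unique-suffix L u

  linked-suffix : ∀ {R : A → A → Set} (L : List A) {M} → Linked R (L ++ M) → Linked R M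
  linked-suffix []      l = l
  linked-suffix (_ ∷ L) l = linked-suffix L (linked-tail l)

  suffix-ends : ∀ (L : List A) {b M ys z} → L ++ b ∷ M ≡ ys ∷ʳ z → Σ (List A) λ zs → b ∷ M ≡ zs ∷ʳ z
  suffix-ends []      {ys = ys}     eq = ys , eq
  suffix-ends (_ ∷ L) {ys = []}     eq = ⊥-elim (nonempty-++ L (∷-injectiveʳ eq))
  suffix-ends (_ ∷ L) {ys = _ ∷ ys} eq = suffix-ends L (∷-injectiveʳ eq)

  split-before-last : ∀ (zs : List A) {v z} → v ∈ₗ zs ∷ʳ z → v ≢ z →
    Σ (List A) λ as → Σ (List A) λ bs → zs ∷ʳ z ≡ (as ∷ʳ v) ++ (bs ∷ʳ z)
  split-before-last zs {v} {z} v∈ v≢z with ∈-++⁻ zs v∈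
  ... | inj₂ (here v≡z) = ⊥-elim (v≢z v≡z)
  ... | inj₁ v∈zs with ∈-∃++ v∈zs
  ... | as , bs , eq = as , bs , (begin
    zs ∷ʳ z                       ≡⟨ cong (_∷ʳ z) eq ⟩
    (as ++ [ v ] ++ bs) ++ [ z ]   ≡⟨ ++-assoc as ([ v ] ++ bs) [ z ] ⟩
    as ++ v ∷ (bs ++ [ z ])        ≡⟨ sym (++-assoc as [ v ] (bs ++ [ z ])) ⟩
    (as ∷ʳ v) ++ (bs ∷ʳ z)        ∎)
    where open ≡-Reasoning

  prefix-before : ∀ (L : List A) {b M} xs {p Z} → L ++ b ∷ M ≡ xs ++ p ∷ Z → p ∉ₗ L →
    Σ (List A) λ W → xs ∷ʳ p ≡ L ++ b ∷ W
  prefix-before []      []       eq p∉ with ∷-injectiveˡ eq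
  ... | refl = [] , refl
  prefix-before []      (x ∷ xs) {p} eq p∉ with ∷-injectiveˡ eq
  ... | refl = xs ∷ʳ p , refl
  prefix-before (a ∷ L) []       eq p∉ = ⊥-elim (p∉ (here (sym (∷-injectiveˡ eq))))
  prefix-before (a ∷ L) (x ∷ xs) eq p∉ with ∷-injectiveˡ eq
  ... | refl with prefix-before L xs (∷-injectiveʳ eq) (λ p∈ → p∉ (there p∈))
  ... | W , eqW = W , cong (a ∷_) eqW

∣p∪q∣≤∣p∣+∣q∣ : ∀ {n} (p q : Subset n) → ∣ p ∪ q ∣ ≤ ∣ p ∣ + ∣ q ∣
∣p∪q∣≤∣p∣+∣q∣ []            []            = z≤n
∣p∪q∣≤∣p∣+∣q∣ (inside ∷ p)  (inside ∷ q)  =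
  s≤s (≤-trans (∣p∪q∣≤∣p∣+∣q∣ p q) (≤-trans (n≤1+n _) (≤-reflexive (sym (+-suc ∣ p ∣ ∣ q ∣)))))
∣p∪q∣≤∣p∣+∣q∣ (inside ∷ p)  (outside ∷ q) = s≤s (∣p∪q∣≤∣p∣+∣q∣ p q)
∣p∪q∣≤∣p∣+∣q∣ (outside ∷ p) (inside ∷ q)  =
  ≤-trans (s≤s (∣p∪q∣≤∣p∣+∣q∣ p q)) (≤-reflexive (sym (+-suc ∣ p ∣ ∣ q ∣)))
∣p∪q∣≤∣p∣+∣q∣ (outside ∷ p) (outside ∷ q) = ∣p∪q∣≤∣p∣+∣q∣ p q

module _ {n : ℕ} where

  fromList : List (Fin n) → Subset n
  fromList []      = ⊥
  fromList (a ∷ l) = ⁅ a ⁆ ∪ fromList l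

  ∣fromList∣≤length : ∀ L → ∣ fromList L ∣ ≤ length L
  ∣fromList∣≤length []      = ≤-reflexive (∣⊥∣≡0 n)
  ∣fromList∣≤length (a ∷ L) =
    ≤-trans (∣p∪q∣≤∣p∣+∣q∣ ⁅ a ⁆ (fromList L))
      (≤-trans (≤-reflexive (cong (_+ ∣ fromList L ∣) (∣⁅x⁆∣≡1 a))) (s≤s (∣fromList∣≤length L)))

  ∈-fromList : ∀ {v} L → v ∈ₗ L → v ∈ fromList L
  ∈-fromList (a ∷ L) (here refl) = x∈p∪q⁺ (inj₁ (x∈⁅x⁆ a))
  ∈-fromList (a ∷ L) (there v∈)  = x∈p∪q⁺ (inj₂ (∈-fromList L v∈))

  covered-card : (T : Subset n) (L : List (Fin n)) → (∀ v → v ∈ T → v ∈ₗ L) → ∣ T ∣ ≤ length L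
  covered-card T L cover =
    ≤-trans (p⊆q⇒∣p∣≤∣q∣ (λ {v} v∈T → ∈-fromList L (cover v v∈T))) (∣fromList∣≤length L)

  unique-card : ∀ (xs : List (Fin n)) (S : Subset n) → Unique xs → (∀ x → x ∈ₗ xs → x ∈ S) →
    length xs ≤ ∣ S ∣
  unique-card []       S u          inS = z≤n
  unique-card (x ∷ xs) S (x∉ ∷ u)   inS =
    ≤-trans (s≤s (unique-card xs (S - x) u inS-x)) (x∈p⇒∣p-x∣<∣p∣ (inS x (here refl)))
    where
    inS-x : ∀ y → y ∈ₗ xs → y ∈ S - x
    inS-x y y∈ = x∈p∧x≢y⇒x∈p-y (inS y (there y∈)) (λ y≡x → all-lookup x∉ y∈ (sym y≡x))

  elements : Subset n → List (Fin n)
  elements S = filter (_∈ₛ? S) (allFin n)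

  length-elements : ∀ S → length (elements S) ≤ ∣ S ∣
  length-elements S = unique-card (elements S) S (Unique.filter⁺ (_∈ₛ? S) (Unique.allFin⁺ n))
    (λ x x∈ → proj₂ (∈-filter⁻ (_∈ₛ? S) {xs = allFin n} x∈))

  ∈-elements : ∀ {s} S → s ∈ S → s ∈ₗ elements S
  ∈-elements {s} S s∈S = ∈-filter⁺ (_∈ₛ? S) (∈-allFin s) s∈S

two-images-card : ∀ {m n} (S : Subset m) (T : Subset n) (f g : Fin m → Fin n) →
  (∀ v → v ∈ T → Σ (Fin m) λ s → s ∈ S × (v ≡ f s ⊎ v ≡ g s)) → ∣ T ∣ ≤ 2 * ∣ S ∣
two-images-card S T f g image = begin
  ∣ T ∣                               ≤⟨ covered-card T (map f Ls ++ map g Ls) cover ⟩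
  length (map f Ls ++ map g Ls)        ≡⟨ length-++ (map f Ls) ⟩
  length (map f Ls) + length (map g Ls) ≡⟨ cong₂ _+_ (length-map f Ls) (length-map g Ls) ⟩
  length Ls + length Ls                ≤⟨ +-mono-≤ (length-elements S) (length-elements S) ⟩
  ∣ S ∣ + ∣ S ∣                         ≡⟨ cong (∣ S ∣ +_) (sym (+-identityʳ ∣ S ∣)) ⟩
  2 * ∣ S ∣                             ∎
  where
  open ≤-Reasoning
  Ls : List (Fin _)
  Ls = elements S
  cover : ∀ v → v ∈ T → v ∈ₗ map f Ls ++ map g Ls
  cover v v∈T with image v v∈T
  ... | s , s∈S , inj₁ refl = ∈-++⁺ˡ (∈-map⁺ f (∈-elements S s∈S))
  ... | s , s∈S , inj₂ refl = ∈-++⁺ʳ (map f Ls) (∈-map⁺ g (∈-elements S s∈S))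

module _ {n : ℕ} where

  -- after L s : the entry following s in L (s itself if there is none).
  after : List (Fin n) → Fin n → Fin n
  after []          s = s
  after (a ∷ [])    s = s
  after (a ∷ b ∷ l) s = if does (a ≟ s) then b else after (b ∷ l) s

  before : List (Fin n) → Fin n → Fin n
  before L = after (reverse L)

  consec⇒after : ∀ {L : List (Fin n)} {s v} → Unique L → Consec L s v → after L s ≡ v
  consec⇒after {_ ∷ []} _ (there ())
  consec⇒after {a ∷ b ∷ l} {s} u c with a ≟ s
  consec⇒after u        here      | yes _    = refl
  consec⇒after (a∉ ∷ _) (there c) | yes refl = ⊥-elim (all-lookup a∉ (consec-head-∈ c) refl)
  consec⇒after u        here      | no a≢a   = ⊥-elim (a≢a refl)
  consec⇒after (_ ∷ u)  (there c) | no _     = consec⇒after u c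

  consec⇒before : ∀ {L : List (Fin n)} {s v} → Unique L → Consec L v s → before L s ≡ v
  consec⇒before {L} u c = consec⇒after (unique-resp-↭ (↭-sym (↭-reverse L)) u) (consec-reverse c)

module Rotations {n : ℕ} (G : Graph n) where

  ends-unique : ∀ {Q : List (Fin n)} {x y} → EndsAt G Q x → EndsAt G Q y → x ≡ y
  ends-unique (zs , refl) (ws , eq) = ∷ʳ-injectiveʳ zs ws eq

  rotated-ends : ∀ (xs : List (Fin n)) p ys e → EndsAt G ((xs ∷ʳ p) ++ (ys ∷ʳ e)) e
  rotated-ends xs p ys e = (xs ∷ʳ p) ++ ys , sym (++-assoc (xs ∷ʳ p) ys [ e ])

  rotation-↭ : ∀ {Q R} → Rotation G Q R → R ↭ Q
  rotation-↭ (xs , p , ys , e , refl , _ , refl) = ++⁺ˡ (xs ∷ʳ p) (↭-reverse (ys ∷ʳ e))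

  rotation-path : ∀ {Q R} → IsPath G Q → Rotation G Q R → IsPath G R
  rotation-path (neQ , uQ , lQ) rot@(xs , p , ys , e , refl , adj , refl) =
    ↭-nonempty (rotation-↭ rot) neQ , unique-resp-↭ (↭-sym (rotation-↭ rot)) uQ , consec⇒linked _ linked
    where
    linked : ∀ {a b} → Consec ((xs ∷ʳ p) ++ reverse (ys ∷ʳ e)) a b → Adj G a b
    linked c with reverse-tail-consec xs p ys e c
    ... | inj₁ (inj₁ c')     = linked⇒consec lQ c'
    ... | inj₁ (inj₂ c')     = Graph.sym G (linked⇒consec lQ c')
    ... | inj₂ (refl , refl) = Graph.sym G adj

  derived-path : ∀ {P Q} → IsPath G P → Derived G P Q → IsPath G Q × (Q ↭ P)
  derived-path path ε = path , ↭-refl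
  derived-path path (rot ◅ rots) with derived-path (rotation-path path rot) rots
  ... | pathQ , Q↭ = pathQ , ↭-trans Q↭ (rotation-↭ rot)

  rotation-at : ∀ (xs : List (Fin n)) p ys e → Adj G e p → Σ (Fin n) λ y → Σ (List (Fin n)) λ R →
    Rotation G ((xs ∷ʳ p) ++ (ys ∷ʳ e)) R × EndsAt G R y × Consec ((xs ∷ʳ p) ++ (ys ∷ʳ e)) p y
  rotation-at xs p [] e adj =
    e , _ , (xs , p , [] , e , refl , adj , refl) , (xs ∷ʳ p , refl) , consec-joint xs
  rotation-at xs p (y ∷ ys) e adj =
    y , _ , (xs , p , y ∷ ys , e , refl , adj , refl) , (_ , new-end) , consec-joint xs
    where
    new-end : (xs ∷ʳ p) ++ reverse (y ∷ ys ∷ʳ e) ≡ ((xs ∷ʳ p) ++ reverse (ys ∷ʳ e)) ∷ʳ y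
    new-end = trans (cong ((xs ∷ʳ p) ++_) (unfold-reverse y (ys ∷ʳ e)))
                    (sym (++-assoc (xs ∷ʳ p) (reverse (ys ∷ʳ e)) [ y ]))

  extend-path : ∀ {Q u v} → IsPath G Q → EndsAt G Q u → Adj G u v → v ∉ₗ Q → IsPath G (Q ∷ʳ v)
  extend-path {Q} (_ , uQ , lQ) endQ adj v∉ =
    nonempty-++ Q , Unique.++⁺ uQ ([] ∷ []) (λ { (v∈ , here refl) → v∉ v∈ }) , consec⇒linked _ linked
    where
    linked : ∀ {a b} → Consec (Q ∷ʳ _) a b → Adj G a b
    linked c with consec-split Q c
    ... | inj₁ c'                           = linked⇒consec lQ c'
    ... | inj₂ (inj₁ (there ()))
    ... | inj₂ (inj₂ ((L' , eq) , (_ , eqM))) with ∷-injectiveˡ eqM | ends-unique endQ (L' , eq)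
    ... | refl | refl = adj

  longest-end-nbrs : ∀ {P Q u v} → IsLongestPath G P → IsPath G Q → length Q ≡ length P →
    EndsAt G Q u → Adj G u v → v ∈ₗ Q
  longest-end-nbrs {P} {Q} {u} {v} (_ , maximal) pathQ len endQ adj with any? (v ≟_) Q
  ... | yes v∈ = v∈
  ... | no v∉  = ⊥-elim (<-irrefl refl (<-≤-trans longer
                   (≤-trans (maximal (Q ∷ʳ v) (extend-path pathQ endQ adj v∉)) (≤-reflexive (sym len)))))
    where
    longer : length Q < length (Q ∷ʳ v)
    longer = subst (length Q <_) (sym (length-++ Q)) (m<m+n (length Q) (s≤s z≤n))

  ends-differ : ∀ {b M} → Unique (b ∷ M) → EndsAt G (b ∷ M) b → ¬ (2 ≤ length (b ∷ M))
  ends-differ _          ([] , eq)     long with ∷-injectiveʳ eq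
  ... | refl = <-irrefl refl long
  ends-differ (b∉M ∷ _) (_ ∷ ys , eq) _ =
    all-lookup b∉M (subst (_ ∈ₗ_) (sym (∷-injectiveʳ eq)) (∈-++⁺ʳ ys (here refl))) refl

  close-cycle : ∀ {b t M} → IsPath G (b ∷ M) → EndsAt G (b ∷ M) t → (t ≡ b ⊎ Adj G t b) → IsCycle G (b ∷ M)
  close-cycle {b} {t} {M} path endC closing =
    path , λ long → b , t , (M , refl) , endC , closing-edge long closing
    where
    closing-edge : 3 ≤ length (b ∷ M) → t ≡ b ⊎ Adj G t b → Adj G t b
    closing-edge _    (inj₂ adj)  = adj
    closing-edge long (inj₁ refl) = ⊥-elim (ends-differ (proj₁ (proj₂ path)) endC (≤-trans (n≤1+n 2) long))

module LongestPath {n : ℕ} (G : Graph n) (P : List (Fin n)) (longest : IsLongestPath G P)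
                   (X : Subset n) (connected : IsConnectedEndingSet G P X)
                   (N : Subset n) (nbhd : IsNeighbourhood G X N) where

  open Rotations G

  unique-P : Unique P
  unique-P = proj₁ (proj₂ (proj₁ longest))

  derived-↭ : ∀ {Q} → Derived G P Q → Q ↭ P
  derived-↭ d = proj₂ (derived-path (proj₁ longest) d)

  on-P : ∀ {Q v} → Derived G P Q → v ∈ₗ Q → v ∈ₗ P
  on-P d = ∈-resp-↭ (derived-↭ d)

  derived-end-nbrs : ∀ {Q u v} → Derived G P Q → EndsAt G Q u → Adj G u v → v ∈ₗ Q
  derived-end-nbrs d =
    longest-end-nbrs longest (proj₁ (derived-path (proj₁ longest) d)) (↭-length (derived-↭ d))

  within⇒derived : ∀ {Q R} → Star (RotationWithin G X) Q R → Derived G Q R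
  within⇒derived = Star.map proj₁

  old-end-in-X : ∀ (xs : List (Fin n)) p ys e → EndsIn G X ((xs ∷ʳ p) ++ (ys ∷ʳ e)) → e ∈ X
  old-end-in-X xs p ys e (x , endX , x∈X) = subst (_∈ X) (ends-unique endX (rotated-ends xs p ys e)) x∈X

  -- Part (i): every vertex of N lies next to an ending vertex along P.

  NearEnd : Fin n → Set
  NearEnd v = Σ (Fin n) λ y → IsEndingVertex G P y × Beside P v y

  KeepsBeside : Fin n → List (Fin n) → Set
  KeepsBeside v Q = ∀ w → Beside Q v w → Beside P v w

  pivot-near-end : ∀ {v Q} xs ys e → KeepsBeside v Q → Derived G P Q →
    Q ≡ (xs ∷ʳ v) ++ (ys ∷ʳ e) → Adj G e v → NearEnd v
  pivot-near-end xs ys e keeps d refl adj with rotation-at xs _ ys e adj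
  ... | y , R , rot , endR , c = y , (R , d ◅◅ (rot ◅ ε) , endR) , keeps y (inj₁ c)

  rotation-keeps-beside : ∀ {v w} (xs : List (Fin n)) p ys e → v ≢ p → v ≢ e →
    Beside ((xs ∷ʳ p) ++ reverse (ys ∷ʳ e)) v w → Beside ((xs ∷ʳ p) ++ (ys ∷ʳ e)) v w
  rotation-keeps-beside xs p ys e v≢p v≢e (inj₁ c) with reverse-tail-consec xs p ys e c
  ... | inj₁ b        = b
  ... | inj₂ (v≡p , _) = ⊥-elim (v≢p v≡p)
  rotation-keeps-beside xs p ys e v≢p v≢e (inj₂ c) with reverse-tail-consec xs p ys e c
  ... | inj₁ b        = swap b
  ... | inj₂ (_ , v≡e) = ⊥-elim (v≢e v≡e)

  outside-X-not-end : ∀ {v u Q} → v ∉ X → EndsIn G X Q → EndsAt G Q u → v ≢ u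
  outside-X-not-end v∉X (x , endX , x∈X) endQ refl = v∉X (subst (_∈ X) (ends-unique endX endQ) x∈X)

  near-end-along : ∀ {v u Q R} → v ∉ X → Derived G P Q → EndsIn G X Q → KeepsBeside v Q →
    Star (RotationWithin G X) Q R → EndsAt G R u → Adj G u v → NearEnd v
  near-end-along v∉X d endsX keeps ε endQ@(zs , refl) adj
    with split-before-last zs (derived-end-nbrs d endQ adj) (outside-X-not-end v∉X endsX endQ)
  ... | as , bs , eq = pivot-near-end as bs _ keeps d eq adj
  near-end-along {v} v∉X d endsX keeps ((rot@(xs , p , ys , e , refl , adj' , refl) , endsX') ◅ rots) endR adj
    with v ≟ p
  ... | yes refl = pivot-near-end xs ys e keeps d refl adj'
  ... | no v≢p   = near-end-along v∉X (d ◅◅ (rot ◅ ε)) endsX'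
                     (λ w b → keeps w (rotation-keeps-beside xs p ys e v≢p v≢e b)) rots endR adj
    where
    v≢e : v ≢ e
    v≢e refl = v∉X (old-end-in-X xs p ys e endsX)

  nbhd-near-end : ∀ v → v ∈ N → NearEnd v
  nbhd-near-end v v∈N with proj₁ (nbhd v) v∈N
  ... | v∉X , u , u∈X , adj with proj₂ connected u u∈X
  ... | _ , endsX , rots , endR = near-end-along v∉X ε endsX (λ _ b → b) rots endR adj

  nbhd-around-ends : ∀ v → v ∈ N → Σ (Fin n) λ y → IsEndingVertex G P y × (v ≡ before P y ⊎ v ≡ after P y)
  nbhd-around-ends v v∈N with nbhd-near-end v v∈N
  ... | y , endY , inj₁ c = y , endY , inj₁ (sym (consec⇒before unique-P c))
  ... | y , endY , inj₂ c = y , endY , inj₂ (sym (consec⇒after unique-P c))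

  -- Part (ii): a cycle through the cover vertices N ∪ X.

  Cover : Fin n → Set
  Cover v = v ∈ (N ∪ X)

  -- Cover vertices are ending vertices or neighbours of ending vertices, hence on P.
  cover-on-P : ∀ v → Cover v → v ∈ₗ P
  cover-on-P v v∈ with x∈p∪q⁻ N X v∈
  ... | inj₂ v∈X with proj₁ connected v v∈X
  ...   | _ , d , (zs , refl) = on-P d (∈-++⁺ʳ zs (here refl))
  cover-on-P v v∈ | inj₁ v∈N with proj₁ (nbhd v) v∈N
  ... | _ , u , u∈X , adj with proj₁ connected u u∈X
  ...   | _ , d , endQ = on-P d (derived-end-nbrs d endQ adj)

  -- The pivot of a rotation of a path ending in X is adjacent to that end, so a cover vertex.
  pivot-covered : ∀ (xs : List (Fin n)) p ys e → EndsIn G X ((xs ∷ʳ p) ++ (ys ∷ʳ e)) → Adj G e p → Cover p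
  pivot-covered xs p ys e endsX adj with p ∈ₛ? X
  ... | yes p∈X = x∈p∪q⁺ (inj₂ p∈X)
  ... | no p∉X  = x∈p∪q⁺ (inj₁ (proj₂ (nbhd p) (p∉X , e , old-end-in-X xs p ys e endsX , adj)))

  prefix-kept : ∀ {A b M Q R} → All (λ v → ¬ Cover v) A → EndsIn G X Q →
    Star (RotationWithin G X) Q R → Q ≡ A ++ b ∷ M → Σ (List (Fin n)) λ M' → R ≡ A ++ b ∷ M'
  prefix-kept {M = M} free endsX ε eq = M , eq
  prefix-kept {A} {b} free endsX (((xs , p , ys , e , refl , adj , refl) , endsX') ◅ rots) eq
    with prefix-before A xs (trans (sym eq) (++-assoc xs [ p ] (ys ∷ʳ e)))
           (λ p∈A → all-lookup free p∈A (pivot-covered xs p ys e endsX adj))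
  ... | W , eqW = prefix-kept free endsX' rots
    (trans (cong (_++ reverse (ys ∷ʳ e)) eqW) (++-assoc A (b ∷ W) (reverse (ys ∷ʳ e))))

  anchor : ∀ b → Cover b → Σ (Fin n) λ t → t ∈ X × (t ≡ b ⊎ Adj G t b)
  anchor b b∈ with x∈p∪q⁻ N X b∈
  ... | inj₂ b∈X = b , b∈X , inj₁ refl
  ... | inj₁ b∈N with proj₁ (nbhd b) b∈N
  ...   | _ , u , u∈X , adj = u , u∈X , inj₂ adj

  first-cover : (Σ (List (Fin n)) λ A → Σ (Fin n) λ b → Σ (List (Fin n)) λ M →
                   P ≡ A ++ b ∷ M × All (λ v → ¬ Cover v) A × Cover b)
              ⊎ All (λ v → ¬ Cover v) P
  first-cover with first (λ v → swap (toSum (v ∈ₛ? (N ∪ X)))) P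
  ... | inj₂ none = inj₂ none
  ... | inj₁ fst  = inj₁ (decompose (toView fst))
    where
    decompose : ∀ {L} → FirstView (λ v → ¬ Cover v) Cover L → Σ (List (Fin n)) λ A → Σ (Fin n) λ b →
      Σ (List (Fin n)) λ M → L ≡ A ++ b ∷ M × All (λ v → ¬ Cover v) A × Cover b
    decompose (First._++_∷_ free b∈ M) = _ , _ , M , refl , free , b∈

  -- With no cover vertex any single vertex is a cycle; otherwise rotate inside X
  -- towards the anchor of the first cover vertex b and keep the segment from b on.
  cycle-through-cover : Fin n → Σ (List (Fin n)) λ C → IsCycle G C × (∀ v → Cover v → v ∈ₗ C)
  cycle-through-cover p₀ with first-cover
  ... | inj₂ none = [ p₀ ] , close-cycle ((λ ()) , [] ∷ [] , [-]) ([] , refl) (inj₁ refl) ,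
                    λ v v∈ → ⊥-elim (all-lookup none (cover-on-P v v∈) v∈)
  ... | inj₁ (A , b , M , eqP , free , b∈) with anchor b b∈
  ... | t , t∈X , closing with proj₂ connected t t∈X
  ... | Q , endsX , rots , (zs , endQ) with prefix-kept free endsX rots eqP
  ... | M' , eqQ = b ∷ M' , close-cycle pathC endC closing , covered
    where
    d : Derived G P Q
    d = within⇒derived rots
    pathQ : IsPath G Q
    pathQ = proj₁ (derived-path (proj₁ longest) d)
    pathC : IsPath G (b ∷ M')
    pathC = (λ ()) , unique-suffix A (subst Unique eqQ (proj₁ (proj₂ pathQ))) ,
            linked-suffix A (subst (Linked (Adj G)) eqQ (proj₂ (proj₂ pathQ)))
    endC : EndsAt G (b ∷ M') t
    endC = suffix-ends A (trans (sym eqQ) endQ)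
    covered : ∀ v → Cover v → v ∈ₗ b ∷ M'
    covered v v∈ with ∈-++⁻ A (subst (v ∈ₗ_) eqQ (∈-resp-↭ (↭-sym (derived-↭ d)) (cover-on-P v v∈)))
    ... | inj₁ v∈A = ⊥-elim (all-lookup free v∈A v∈)
    ... | inj₂ v∈C = v∈C

lemma2p1 : {n : ℕ} (G : Graph n) (p₀ : Fin n) (P : List (Fin n))
    → IsLongestPath G P → StartsAt G P p₀
    → (S : Subset n) → (∀ x → (x ∈ S → IsEndingVertex G P x) × (IsEndingVertex G P x → x ∈ S))
    → (X : Subset n) → IsConnectedEndingSet G P X
    → (N : Subset n) → IsNeighbourhood G X N
    → (∣ N ∣ ≤ 2 * ∣ S ∣)
      × (Σ (List (Fin n)) λ C → IsCycle G C × (∀ v → v ∈ (N ∪ X) → v ∈ₗ C))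
lemma2p1 G p₀ P longest _ S ending X connected N nbhd =
  two-images-card S N (before P) (after P) around-S , cycle-through-cover p₀
  where
  open LongestPath G P longest X connected N nbhd
  around-S : ∀ v → v ∈ N → Σ (Fin _) λ s → s ∈ S × (v ≡ before P s ⊎ v ≡ after P s)
  around-S v v∈N with nbhd-around-ends v v∈N
  ... | y , endY , pos = y , proj₂ (ending y) endY , pos
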